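{- Let $G$ be a finite chordal graph and let $I^*$ be a maximum independent set of $G$. Then every independent set $S$ that can be returned by \textsc{Greedy} on $G$ (for any way of breaking ties) satisfies $|S| \geq \frac{1}{2}|I^*|$.
   Context: All graphs are finite, simple and undirected. For a vertex $v$, $N(v)$ is its set of neighbours, $N[v]=N(v)\cup\{v\}$, $d(v)=|N(v)|$, and $\delta(G)=\min_{v} d(v)$. A graph is chordal if every simple cycle on at least 4 vertices has two non-consecutive vertices that are adjacent. The minimum-degree greedy algorithm \textsc{Greedy} computes an independent set as follows: start with $S=\emptyset$; while the current graph $G$ is nonempty, choose any vertex $v$ with $d(v)=\delta(G)$ (ties among minimum-degree vertices are broken arbitrarily, i.e. adversarially), add $v$ to $S$, and replace $G$ by $G\setminus N[v]$. A solution "can be returned by \textsc{Greedy}" if it is the output for some sequence of tie-breaking choices. -}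

module Defs where

open import Data.Nat using (ℕ; suc; _≤_)
open import Data.Bool using (Bool; true; false)
open import Data.Fin using (Fin; toℕ)
open import Data.Fin.Subset using (Subset; _∈_; _∉_; _∩_; _∪_; ∁; ⁅_⁆; ∣_∣; ⊤; ⊥)
open import Data.Vec using (tabulate)
open import Data.Product using (_×_; ∃-syntax)
open import Data.Sum using (_⊎_)
open import Relation.Binary.PropositionalEquality using (_≡_; _≢_)
open import Relation.Nullary using (¬_)
open import Function.Definitions using (Injective)

record Graph (n : ℕ) : Set where
  field
    adj   : Fin n → Fin n → Bool
    sym   : ∀ u v → adj u v ≡ adj v u
    irrefl : ∀ v → adj v v ≡ false

open Graph public

Adj : ∀ {n} → Graph n → Fin n → Fin n → Set
Adj G u v = adj G u v ≡ true

N : ∀ {n} → Graph n → Fin n → Subset n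
N G v = tabulate (adj G v)

N[_] : ∀ {n} → Graph n → Fin n → Subset n
N[ G ] v = N G v ∪ ⁅ v ⁆

deg : ∀ {n} → Graph n → Subset n → Fin n → ℕ
deg G R v = ∣ N G v ∩ R ∣

Consec : (k : ℕ) → Fin k → Fin k → Set
Consec k i j = (suc (toℕ i) ≡ toℕ j) ⊎ ((suc (toℕ i) ≡ k) × (toℕ j ≡ 0))

IsCycle : ∀ {n} → Graph n → (k : ℕ) → (Fin k → Fin n) → Set
IsCycle G k c = Injective _≡_ _≡_ c × (∀ i j → Consec k i j → Adj G (c i) (c j))

Chordal : ∀ {n} → Graph n → Set
Chordal {n} G =
  ∀ (k : ℕ) → 4 ≤ k → (c : Fin k → Fin n) → IsCycle G k c →
  ∃[ i ] ∃[ j ] (i ≢ j × ¬ Consec k i j × ¬ Consec k j i × Adj G (c i) (c j))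

Independent : ∀ {n} → Graph n → Subset n → Set
Independent G I = ∀ u v → u ∈ I → v ∈ I → ¬ Adj G u v

MaximumIndependent : ∀ {n} → Graph n → Subset n → Set
MaximumIndependent G I =
  Independent G I × (∀ J → Independent G J → ∣ J ∣ ≤ ∣ I ∣)

-- GreedyRun G R S : running Greedy on the induced subgraph G[R] can return S
-- (for some tie-breaking among minimum-degree vertices).
data GreedyRun {n : ℕ} (G : Graph n) : Subset n → Subset n → Set where
  done : ∀ {R} → (∀ v → v ∉ R) → GreedyRun G R ⊥
  step : ∀ {R S} (v : Fin n) → v ∈ R →
         (∀ u → u ∈ R → deg G R v ≤ deg G R u) →
         GreedyRun G (R ∩ ∁ (N[ G ] v)) S →
         GreedyRun G R (⁅ v ⁆ ∪ S)

GreedyOutput : ∀ {n} → Graph n → Subset n → Set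
GreedyOutput G S = GreedyRun G ⊤ S

{-# OPTIONS --safe #-}
module Submission where

-- If Greedy on G[R] can return S, J ⊆ R is independent and W ⊆ R consists of vertices
-- in pairwise distinct components of G[R], then |J| + |W| ≤ 2|S|; the theorem is the
-- case R = V(G), J = I*, W = ∅. Let Greedy pick v and put T = J ∩ N[v]. If |T| ≤ 1,
-- drop T from J and from W the (at most one) vertex in the component of v. If |T| ≥ 2,
-- then T ⊆ N(v), and d(v) ≤ d(u) forces each u ∈ T to have a private neighbour x_u
-- outside N[v]: otherwise T and N(u) ∖ {v} would be disjoint subsets of N(v). By
-- chordality the x_u lie in distinct components of G[R ∖ N[v]], since a shortest path
-- between x_u and x_u′ there, closed up through u, v, u′, would be a chordless cycle
-- of length at least 4; they also avoid the components of the vertices of W not joined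
-- to v. So W can be replaced by these x_u and the rest of W. Either way |J| + |W| drops
-- by at most 2 while |S| drops by 1.

open import Defs hiding (sym)
open import Data.Nat as ℕ using (ℕ; zero; suc; _+_; _*_; _≤_; _<_; z≤n; s≤s; z<s; _≤?_)
open import Data.Nat.Properties hiding (_≟_)
open import Data.Bool as Bool using (true; false)
open import Data.Fin using (Fin; toℕ) renaming (zero to fzero; suc to fsuc)
open import Data.Fin.Properties using (_≟_; toℕ<n; toℕ-injective)
  renaming (suc-injective to fsuc-injective)
open import Data.Fin.Subset using (Subset; _∈_; _∉_; _⊆_; _∩_; _∪_; ∁; ⁅_⁆; ∣_∣; ⊤)
open import Data.Vec.Base using ([]; _∷_; here; there)
open import Data.Vec.Properties using (lookup∘tabulate; lookup⇒[]=; []=⇒lookup)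
open import Data.Fin.Subset.Properties
  using (x∈p∧x≢y⇒x∈p-y; x∈p⇒∣p-x∣<∣p∣; x∈p∪q⁺; x∈p∪q⁻; x∈p∩q⁺; x∈p∩q⁻; x∈⁅x⁆; x∈⁅y⁆⇒x≡y;
         x∉p⇒x∈∁p; x∈∁p⇒x∉p; ∉⊥; ∈⊤)
open import Data.List using (List; []; _∷_; _++_; length; map; filter)
open import Data.List.Properties using (length-map; length-++)
open import Data.List.Membership.Propositional using () renaming (_∈_ to _∈ₗ_)
open import Data.List.Relation.Unary.Any using (here; there)
open import Data.List.Relation.Unary.All as All using (All; []; _∷_)
import Data.List.Relation.Unary.All.Properties as All
open import Data.List.Relation.Unary.AllPairs as AllPairs using (AllPairs; []; _∷_)
import Data.List.Relation.Unary.AllPairs.Properties as AllPairs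
open import Data.List.Relation.Unary.Unique.Propositional using (Unique)
import Data.List.Relation.Unary.Unique.Propositional.Properties as Unique
open import Data.List.Relation.Binary.Pointwise using (Pointwise; []; _∷_; Pointwise-length)
open import Data.Product using (Σ; ∃; _×_; _,_; proj₁; proj₂)
open import Data.Sum using (_⊎_; inj₁; inj₂; [_,_])
open import Data.Empty using (⊥-elim)
open import Data.Nat.Induction using (<-rec)
open import Data.Nat.Tactic.RingSolver using (solve-∀)
open import Relation.Binary using (tri<; tri≈; tri>)
open import Effect.Monad using (RawMonad)
open import Level using (0ℓ)
open import Function using (_∘_)
open import Function.Definitions using (Injective)
open import Relation.Nullary using (¬_; yes; no; Dec; contradiction)
open import Relation.Nullary.Negation using (DoubleNegation; ¬¬-Monad)
open import Relation.Nullary.Decidable using (¬¬-excluded-middle; _⊎-dec_; decidable-stable)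
open import Relation.Unary using (Decidable)
open import Relation.Unary.Properties using (∁?)
open import Relation.Binary.Construct.Closure.ReflexiveTransitive as Star using (Star; ε; _◅_; _◅◅_)
open import Relation.Binary.PropositionalEquality using (_≡_; _≢_; refl; sym; trans; cong; subst; subst₂)

open RawMonad (¬¬-Monad {0ℓ}) using (pure; _>>=_)

-- Lists and finite subsets

module _ {A : Set} where

  length-filter-∁ : ∀ {P : A → Set} (P? : Decidable P) xs →
                    length xs ≡ length (filter P? xs) + length (filter (∁? P?) xs)
  length-filter-∁ P? [] = refl
  length-filter-∁ P? (x ∷ xs) with P? x
  ... | yes _ = cong suc (length-filter-∁ P? xs)
  ... | no _  = trans (cong suc (length-filter-∁ P? xs)) (sym (+-suc _ _))

  length≤1 : ∀ {P : A → Set} {R : A → A → Set} → (∀ {x y} → P x → P y → R x y) →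
             ∀ {xs} → AllPairs (λ x y → ¬ R x y) xs → All P xs → length xs ≤ 1
  length≤1 related [] [] = z≤n
  length≤1 related (_ ∷ []) (_ ∷ []) = s≤s z≤n
  length≤1 related ((¬xRy ∷ _) ∷ _) (px ∷ py ∷ _) = ⊥-elim (¬xRy (related px py))

  length≤1+length-filter-∁ : ∀ {P : A → Set} (P? : Decidable P) xs → length (filter P? xs) ≤ 1 →
                             length xs ≤ suc (length (filter (∁? P?) xs))
  length≤1+length-filter-∁ P? xs ≤1 rewrite length-filter-∁ P? xs = +-monoˡ-≤ _ ≤1

  All⇒AllPairs : ∀ {P : A → Set} {R : A → A → Set} → (∀ {x y} → P x → P y → R x y) →
                 ∀ {xs} → All P xs → AllPairs R xs
  All⇒AllPairs related [] = []
  All⇒AllPairs related (px ∷ pxs) = All.map (related px) pxs ∷ All⇒AllPairs related pxs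

module _ {A B : Set} {P : A → B → Set} where

  choose : ∀ {xs} → All (λ x → ∃ (P x)) xs → ∃ (Pointwise P xs)
  choose [] = [] , []
  choose ((y , p) ∷ ps) with choose ps
  ... | ys , qs = y ∷ ys , p ∷ qs

  Pointwise⇒All : ∀ {Q : B → Set} → (∀ {x y} → P x y → Q y) → ∀ {xs ys} → Pointwise P xs ys → All Q ys
  Pointwise⇒All f [] = []
  Pointwise⇒All f (p ∷ ps) = f p ∷ Pointwise⇒All f ps

  Pointwise⇒AllPairs : ∀ {R : A → A → Set} {S : B → B → Set} →
                       (∀ {x x′ y y′} → R x x′ → P x y → P x′ y′ → S y y′) →
                       ∀ {xs ys} → AllPairs R xs → Pointwise P xs ys → AllPairs S ys
  Pointwise⇒AllPairs f [] [] = []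
  Pointwise⇒AllPairs {R = R} {S} f (r ∷ rs) (p ∷ ps) = head r ps ∷ Pointwise⇒AllPairs f rs ps
    where
    head : ∀ {xs ys} → All (R _) xs → Pointwise P xs ys → All (S _) ys
    head [] [] = []
    head (r ∷ rs) (p′ ∷ ps) = f r p p′ ∷ head rs ps

¬¬-decidable : ∀ {n} (P : Fin n → Set) → DoubleNegation (Decidable P)
¬¬-decidable {zero} P = pure λ ()
¬¬-decidable {suc n} P = do
  P0? ← ¬¬-excluded-middle
  Psuc? ← ¬¬-decidable (P ∘ fsuc)
  pure λ { fzero → P0? ; (fsuc i) → Psuc? i }

elements : ∀ {n} → Subset n → List (Fin n)
elements [] = []
elements (true ∷ p) = fzero ∷ map fsuc (elements p)
elements (false ∷ p) = map fsuc (elements p)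

length-elements : ∀ {n} (p : Subset n) → length (elements p) ≡ ∣ p ∣
length-elements [] = refl
length-elements (true ∷ p) = cong suc (trans (length-map fsuc (elements p)) (length-elements p))
length-elements (false ∷ p) = trans (length-map fsuc (elements p)) (length-elements p)

elements⊆ : ∀ {n} (p : Subset n) → All (_∈ p) (elements p)
elements⊆ [] = []
elements⊆ (true ∷ p) = here ∷ All.map⁺ (All.map there (elements⊆ p))
elements⊆ (false ∷ p) = All.map⁺ (All.map there (elements⊆ p))

elements-unique : ∀ {n} (p : Subset n) → Unique (elements p)
elements-unique [] = []
elements-unique (true ∷ p) =
  All.map⁺ (All.universal (λ _ ()) _) ∷ Unique.map⁺ fsuc-injective (elements-unique p)
elements-unique (false ∷ p) = Unique.map⁺ fsuc-injective (elements-unique p)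

length≤∣∣ : ∀ {n} {p : Subset n} {xs} → Unique xs → All (_∈ p) xs → length xs ≤ ∣ p ∣
length≤∣∣ [] [] = z≤n
length≤∣∣ (x∉xs ∷ xs!) (x∈p ∷ xs⊆p) = ≤-<-trans (length≤∣∣ xs! xs⊆p-x) (x∈p⇒∣p-x∣<∣p∣ x∈p)
  where xs⊆p-x = All.zipWith (λ (y∈p , x≢y) → x∈p∧x≢y⇒x∈p-y y∈p (x≢y ∘ sym)) (xs⊆p , x∉xs)

x∉p⇒∣p∣<∣⁅x⁆∪p∣ : ∀ {n} {x : Fin n} {p} → x ∉ p → ∣ p ∣ < ∣ ⁅ x ⁆ ∪ p ∣
x∉p⇒∣p∣<∣⁅x⁆∪p∣ {x = x} {p} x∉p =
  subst (_≤ ∣ ⁅ x ⁆ ∪ p ∣) (cong suc (length-elements p)) (length≤∣∣ x∷p! x∷p⊆)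
  where
  x∷p! : Unique (x ∷ elements p)
  x∷p! = All.map (λ y∈p x≡y → x∉p (subst (_∈ p) (sym x≡y) y∈p)) (elements⊆ p) ∷ elements-unique p
  x∷p⊆ : All (_∈ ⁅ x ⁆ ∪ p) (x ∷ elements p)
  x∷p⊆ = x∈p∪q⁺ (inj₁ (x∈⁅x⁆ x)) ∷ All.map (x∈p∪q⁺ ∘ inj₂) (elements⊆ p)

skip-length : ∀ i d r → suc i + r + suc d ≡ suc (suc i + d) + r
skip-length = solve-∀

restrict-length : ∀ x j w → suc x + j + suc w ≡ 2 + (j + (x + w))
restrict-length = solve-∀

-- Graphs

module _ {n : ℕ} (G : Graph n) where

  Adj-sym : ∀ {x y} → Adj G x y → Adj G y x
  Adj-sym {x} {y} xy = trans (Graph.sym G y x) xy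

  Adj-irrefl : ∀ {x} → ¬ Adj G x x
  Adj-irrefl {x} xx with trans (sym xx) (irrefl G x)
  ... | ()

  Adj⇒≢ : ∀ {x y} → Adj G x y → x ≢ y
  Adj⇒≢ xy refl = Adj-irrefl xy

  Adj? : ∀ x y → Dec (Adj G x y)
  Adj? x y = adj G x y Bool.≟ true

  Adj⇒∈N : ∀ {v z} → Adj G v z → z ∈ N G v
  Adj⇒∈N {v} {z} vz = lookup⇒[]= z _ (trans (lookup∘tabulate (adj G v) z) vz)

  ∈N⇒Adj : ∀ {v z} → z ∈ N G v → Adj G v z
  ∈N⇒Adj {v} {z} z∈N = trans (sym (lookup∘tabulate (adj G v) z)) ([]=⇒lookup z∈N)

  Near : Fin n → Fin n → Set
  Near v z = z ≡ v ⊎ Adj G v z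

  Near? : ∀ v → Decidable (Near v)
  Near? v z = (z ≟ v) ⊎-dec (Adj? v z)

  Near⇒∈N[] : ∀ {v z} → Near v z → z ∈ N[ G ] v
  Near⇒∈N[] (inj₁ refl) = x∈p∪q⁺ (inj₂ (x∈⁅x⁆ _))
  Near⇒∈N[] (inj₂ vz) = x∈p∪q⁺ (inj₁ (Adj⇒∈N vz))

  ∈N[]⇒Near : ∀ {v z} → z ∈ N[ G ] v → Near v z
  ∈N[]⇒Near {v} z∈N[v] with x∈p∪q⁻ (N G v) ⁅ v ⁆ z∈N[v]
  ... | inj₁ z∈N = inj₂ (∈N⇒Adj z∈N)
  ... | inj₂ z∈⁅v⁆ = inj₁ (x∈⁅y⁆⇒x≡y v z∈⁅v⁆)

  _∖N[_] : Subset n → Fin n → Subset n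
  R ∖N[ v ] = R ∩ ∁ (N[ G ] v)

  ∈∖N[]⁺ : ∀ {R v z} → z ∈ R → ¬ Near v z → z ∈ R ∖N[ v ]
  ∈∖N[]⁺ z∈R ¬near = x∈p∩q⁺ (z∈R , x∉p⇒x∈∁p (¬near ∘ ∈N[]⇒Near))

  ∈∖N[]⁻ : ∀ {R v z} → z ∈ R ∖N[ v ] → z ∈ R × ¬ Near v z
  ∈∖N[]⁻ {R} {v} z∈R∖N[v] with x∈p∩q⁻ R (∁ (N[ G ] v)) z∈R∖N[v]
  ... | z∈R , z∈∁N[v] = z∈R , x∈∁p⇒x∉p z∈∁N[v] ∘ Near⇒∈N[]

  Apart : Fin n → Fin n → Set
  Apart x y = x ≢ y × ¬ Adj G x y

  Connected : Subset n → Fin n → Fin n → Set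
  Connected R = Star λ x y → x ∈ R × y ∈ R × Adj G x y

  Connected-sym : ∀ {R x y} → Connected R x y → Connected R y x
  Connected-sym = Star.reverse λ (x∈R , y∈R , xy) → y∈R , x∈R , Adj-sym xy

  Connected-mono : ∀ {R R′} → R ⊆ R′ → ∀ {x y} → Connected R x y → Connected R′ x y
  Connected-mono R⊆R′ = Star.map λ (x∈R , y∈R , xy) → R⊆R′ x∈R , R⊆R′ y∈R , xy

  Near⇒Connected : ∀ {R v z} → v ∈ R → z ∈ R → Near v z → Connected R v z
  Near⇒Connected _ _ (inj₁ refl) = ε
  Near⇒Connected v∈R z∈R (inj₂ vz) = (v∈R , z∈R , vz) ◅ ε

  -- Walks

  record Walk (Q : Fin n → Set) (a b : Fin n) (k : ℕ) : Set where
    field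
      at : ℕ → Fin n
      at-start : at 0 ≡ a
      at-end : at k ≡ b
      edge : ∀ {i} → i < k → Adj G (at i) (at (suc i))
      inner : ∀ {i} → 0 < i → i < k → Q (at i)

  open Walk

  walk-edge : ∀ {Q a b} → Adj G a b → Walk Q a b 1
  walk-edge {a = a} {b} ab = record
    { at = λ { zero → a ; (suc _) → b }
    ; at-start = refl
    ; at-end = refl
    ; edge = λ { (s≤s z≤n) → ab }
    ; inner = λ { (s≤s _) (s≤s ()) }
    }

  walk-cons : ∀ {Q a x b k} → Adj G a x → Q x → Walk Q x b k → Walk Q a b (suc k)
  walk-cons {Q} {a} ax qx w = record
    { at = λ { zero → a ; (suc i) → at w i }
    ; at-start = refl
    ; at-end = at-end w
    ; edge = λ { {zero} _ → subst (Adj G a) (sym (at-start w)) ax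
               ; {suc i} (s≤s i<k) → edge w i<k }
    ; inner = λ { {suc zero} _ _ → subst Q (sym (at-start w)) qx
                ; {suc (suc i)} _ (s≤s i<k) → inner w z<s i<k }
    }

  walk-map : ∀ {Q Q′ a b k} → (∀ {z} → Q z → Q′ z) → Walk Q a b k → Walk Q′ a b k
  walk-map f w = record
    { at = at w
    ; at-start = at-start w
    ; at-end = at-end w
    ; edge = edge w
    ; inner = λ 0<i i<k → f (inner w 0<i i<k)
    }

  connected⇒walk : ∀ {R a x y b} → Connected R x y → x ∈ R → Adj G a x → Adj G y b → ∃ (Walk (_∈ R) a b)
  connected⇒walk ε x∈R ax xb = 2 , walk-cons ax x∈R (walk-edge xb)
  connected⇒walk ((_ , z∈R , xz) ◅ path) x∈R ax yb =
    let k , w = connected⇒walk path z∈R xz yb in suc k , walk-cons ax x∈R w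

  truncate : ∀ {Q a b k i} (w : Walk Q a b k) → i ≤ k → at w i ≡ b → Walk Q a b i
  truncate w i≤k at-i = record
    { at = at w
    ; at-start = at-start w
    ; at-end = at-i
    ; edge = λ m<i → edge w (<-≤-trans m<i i≤k)
    ; inner = λ 0<m m<i → inner w 0<m (<-≤-trans m<i i≤k)
    }

  skip : (ℕ → Fin n) → ℕ → ℕ → ℕ → Fin n
  skip p i e m with m ≤? i
  ... | yes _ = p m
  ... | no _ = p (m + e)

  skip-≤ : ∀ p e {i m} → m ≤ i → skip p i e m ≡ p m
  skip-≤ p e {i} {m} m≤i with m ≤? i
  ... | yes _ = refl
  ... | no m≰i = contradiction m≤i m≰i

  skip-> : ∀ p e {i m} → i < m → skip p i e m ≡ p (m + e)
  skip-> p e {i} {m} i<m with m ≤? i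
  ... | yes m≤i = contradiction m≤i (<⇒≱ i<m)
  ... | no _ = refl

  skip-walk : ∀ {Q a b} i d r (w : Walk Q a b (suc (suc i + d) + r)) →
              Adj G (at w i) (at w (suc (suc i + d))) → Walk Q a b (suc i + r)
  skip-walk {Q} i d r w bridge = record
    { at = skip p i (suc d)
    ; at-start = trans (skip-≤ p (suc d) {i} z≤n) (at-start w)
    ; at-end = trans (skip-> p (suc d) (s≤s (m≤m+n i r))) (trans (cong p (skip-length i d r)) (at-end w))
    ; edge = edge′
    ; inner = inner′
    }
    where
    p = at w
    i<k : i < suc (suc i + d) + r
    i<k = s≤s (m≤n⇒m≤1+n (≤-trans (m≤m+n i d) (m≤m+n (i + d) r)))
    shift< : ∀ {m} → m < suc i + r → m + suc d < suc (suc i + d) + r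
    shift< {m} m<k′ = subst (m + suc d <_) (skip-length i d r) (+-monoˡ-< (suc d) m<k′)
    edge′ : ∀ {m} → m < suc i + r → Adj G (skip p i (suc d) m) (skip p i (suc d) (suc m))
    edge′ {m} m<k′ with <-cmp m i
    ... | tri< m<i _ _ = subst₂ (Adj G) (sym (skip-≤ p (suc d) (<⇒≤ m<i))) (sym (skip-≤ p (suc d) m<i))
                           (edge w (<-trans m<i i<k))
    ... | tri≈ _ refl _ = subst₂ (Adj G) (sym (skip-≤ p (suc d) ≤-refl)) (sym (skip-> p (suc d) ≤-refl))
                            (subst (λ x → Adj G (p m) (p x)) (sym (cong suc (+-suc m d))) bridge)
    ... | tri> _ _ i<m = subst₂ (Adj G) (sym (skip-> p (suc d) i<m)) (sym (skip-> p (suc d) (m<n⇒m<1+n i<m)))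
                           (edge w (shift< m<k′))
    inner′ : ∀ {m} → 0 < m → m < suc i + r → Q (skip p i (suc d) m)
    inner′ {m} 0<m m<k′ with ≤-<-connex m i
    ... | inj₁ m≤i = subst Q (sym (skip-≤ p (suc d) m≤i)) (inner w 0<m (≤-<-trans m≤i i<k))
    ... | inj₂ i<m = subst Q (sym (skip-> p (suc d) i<m))
                       (inner w (<-≤-trans 0<m (m≤m+n m (suc d))) (shift< m<k′))

  Defect : ∀ {Q a b k} → Walk Q a b k → Set
  Defect {k = k} w =
    ∃ λ i → ∃ λ j → i < j × j ≤ k × (at w i ≡ at w j ⊎ suc i < j × Adj G (at w i) (at w j))

  Induced : ∀ {Q a b k} → Walk Q a b k → Set
  Induced w = ¬ Defect w

  shorten : ∀ {Q a b k} (w : Walk Q a b k) → Defect w → ∃ λ k′ → k′ < k × Walk Q a b k′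
  shorten w (i , j , i<j , j≤k , inj₁ repeat) with m≤n⇒∃[o]m+o≡n i<j | m≤n⇒m<n∨m≡n j≤k
  ... | _ , refl | inj₂ refl = i , i<j , truncate w (<⇒≤ i<j) (trans repeat (at-end w))
  ... | d , refl | inj₁ j<k with m≤n⇒∃[o]m+o≡n j<k
  ...   | r , refl = suc i + r , +-monoˡ-< r (s≤s (s≤s (m≤m+n i d))) ,
                     skip-walk i d r w (subst (λ x → Adj G x (at w (suc (suc i + d)))) (sym repeat)
                                         (edge w j<k))
  shorten w (i , j , _ , j≤k , inj₂ (1+i<j , chord)) with m≤n⇒∃[o]m+o≡n 1+i<j | m≤n⇒∃[o]m+o≡n j≤k
  ... | d , refl | r , refl = suc i + r , +-monoˡ-< r (s≤s (s≤s (m≤m+n i d))) , skip-walk i d r w chord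

  induced-walk : ∀ {Q a b} k → Walk Q a b k → DoubleNegation (∃ λ k′ → Σ (Walk Q a b k′) Induced)
  induced-walk = <-rec _ λ k shorter w → ¬¬-excluded-middle >>= λ where
    (yes defect) → let k′ , k′<k , w′ = shorten w defect in shorter k′<k w′
    (no induced) → pure (k , w , induced)

  -- Chordal graphs

  module ClosedWalk {v a b k} (va : Adj G v a) (vb : Adj G v b)
                    (w : Walk (¬_ ∘ Near v) a b k) (induced : Induced w) where

    cycle : Fin (suc (suc k)) → Fin n
    cycle fzero = v
    cycle (fsuc i) = at w (toℕ i)

    endpoint-or-far : ∀ {m} → m ≤ k → m ≡ 0 ⊎ m ≡ k ⊎ ¬ Near v (at w m)
    endpoint-or-far {m} m≤k with m ℕ.≟ 0 | m ℕ.≟ k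
    ... | yes m≡0 | _ = inj₁ m≡0
    ... | no _ | yes m≡k = inj₂ (inj₁ m≡k)
    ... | no m≢0 | no m≢k = inj₂ (inj₂ (inner w (n≢0⇒n>0 m≢0) (≤∧≢⇒< m≤k m≢k)))

    at≢v : ∀ {m} → m ≤ k → at w m ≢ v
    at≢v m≤k with endpoint-or-far m≤k
    ... | inj₁ refl = Adj⇒≢ va ∘ sym ∘ trans (sym (at-start w))
    ... | inj₂ (inj₁ refl) = Adj⇒≢ vb ∘ sym ∘ trans (sym (at-end w))
    ... | inj₂ (inj₂ far) = far ∘ inj₁

    v-adj⇒endpoint : ∀ {m} → m ≤ k → Adj G v (at w m) → m ≡ 0 ⊎ m ≡ k
    v-adj⇒endpoint m≤k vm with endpoint-or-far m≤k
    ... | inj₁ m≡0 = inj₁ m≡0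
    ... | inj₂ (inj₁ m≡k) = inj₂ m≡k
    ... | inj₂ (inj₂ far) = contradiction (inj₂ vm) far

    at-injective : ∀ {i j} → i ≤ k → j ≤ k → at w i ≡ at w j → i ≡ j
    at-injective {i} {j} i≤k j≤k eq with <-cmp i j
    ... | tri< i<j _ _ = contradiction (i , j , i<j , j≤k , inj₁ eq) induced
    ... | tri≈ _ i≡j _ = i≡j
    ... | tri> _ _ j<i = contradiction (j , i , j<i , i≤k , inj₁ (sym eq)) induced

    chord⇒consecutive : ∀ {i j} → i < j → j ≤ k → Adj G (at w i) (at w j) → suc i ≡ j
    chord⇒consecutive {i} {j} i<j j≤k ij with suc i ℕ.≟ j
    ... | yes 1+i≡j = 1+i≡j
    ... | no 1+i≢j = contradiction (i , j , i<j , j≤k , inj₂ (≤∧≢⇒< i<j 1+i≢j , ij)) induced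

    toℕ≤k : (i : Fin (suc k)) → toℕ i ≤ k
    toℕ≤k i = ≤-pred (toℕ<n i)

    cycle-injective : Injective _≡_ _≡_ cycle
    cycle-injective {fzero} {fzero} _ = refl
    cycle-injective {fzero} {fsuc j} v≡ = contradiction (sym v≡) (at≢v (toℕ≤k j))
    cycle-injective {fsuc i} {fzero} ≡v = contradiction ≡v (at≢v (toℕ≤k i))
    cycle-injective {fsuc i} {fsuc j} eq =
      cong fsuc (toℕ-injective (at-injective (toℕ≤k i) (toℕ≤k j) eq))

    cycle-edges : ∀ x y → Consec (suc (suc k)) x y → Adj G (cycle x) (cycle y)
    cycle-edges fzero fzero (inj₁ ())
    cycle-edges fzero (fsuc y) (inj₁ 1≡1+y) =
      subst (Adj G v ∘ at w) (suc-injective 1≡1+y) (subst (Adj G v) (sym (at-start w)) va)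
    cycle-edges (fsuc x) fzero (inj₁ ())
    cycle-edges (fsuc x) (fsuc y) (inj₁ 2+x≡1+y) =
      subst (Adj G (at w (toℕ x)) ∘ at w) 1+x≡y (edge w (subst (_≤ k) (sym 1+x≡y) (toℕ≤k y)))
      where 1+x≡y = suc-injective 2+x≡1+y
    cycle-edges fzero fzero (inj₂ (() , _))
    cycle-edges (fsuc x) fzero (inj₂ (2+x≡2+k , _)) =
      subst (λ m → Adj G (at w m) v) (sym (suc-injective (suc-injective 2+x≡2+k)))
        (subst (λ z → Adj G z v) (sym (at-end w)) (Adj-sym vb))
    cycle-edges _ (fsuc _) (inj₂ (_ , ()))

    cycle-chordless : ∀ x y → x ≢ y → ¬ Consec (suc (suc k)) x y → ¬ Consec (suc (suc k)) y x →
                      ¬ Adj G (cycle x) (cycle y)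
    cycle-chordless fzero fzero x≢y _ _ _ = x≢y refl
    cycle-chordless fzero (fsuc y) _ ¬xy ¬yx vy with v-adj⇒endpoint (toℕ≤k y) vy
    ... | inj₁ y≡0 = ¬xy (inj₁ (cong suc (sym y≡0)))
    ... | inj₂ y≡k = ¬yx (inj₂ (cong (suc ∘ suc) y≡k , refl))
    cycle-chordless (fsuc x) fzero _ ¬xy ¬yx xv with v-adj⇒endpoint (toℕ≤k x) (Adj-sym xv)
    ... | inj₁ x≡0 = ¬yx (inj₁ (cong suc (sym x≡0)))
    ... | inj₂ x≡k = ¬xy (inj₂ (cong (suc ∘ suc) x≡k , refl))
    cycle-chordless (fsuc x) (fsuc y) x≢y ¬xy ¬yx xy with <-cmp (toℕ x) (toℕ y)
    ... | tri< x<y _ _ = ¬xy (inj₁ (cong suc (chord⇒consecutive x<y (toℕ≤k y) xy)))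
    ... | tri≈ _ x≡y _ = x≢y (cong fsuc (toℕ-injective x≡y))
    ... | tri> _ _ y<x = ¬yx (inj₁ (cong suc (chord⇒consecutive y<x (toℕ≤k x) (Adj-sym xy))))

    ¬Chordal : 2 ≤ k → ¬ Chordal G
    ¬Chordal 2≤k chordal =
      let x , y , x≢y , ¬xy , ¬yx , xy = chordal _ (s≤s (s≤s 2≤k)) cycle (cycle-injective , cycle-edges)
      in cycle-chordless x y x≢y ¬xy ¬yx xy

  module _ (chordal : Chordal G) where

    ¬induced-bypass : ∀ {v a b k} → Adj G v a → Adj G v b → a ≢ b → ¬ Adj G a b →
                      (w : Walk (¬_ ∘ Near v) a b k) → ¬ Induced w
    ¬induced-bypass {k = zero} _ _ a≢b _ w _ = a≢b (trans (sym (at-start w)) (at-end w))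
    ¬induced-bypass {k = suc zero} _ _ _ ¬ab w _ =
      ¬ab (subst₂ (Adj G) (at-start w) (at-end w) (edge w (s≤s z≤n)))
    ¬induced-bypass {k = suc (suc _)} va vb _ _ w induced =
      ClosedWalk.¬Chordal va vb w induced (s≤s (s≤s z≤n)) chordal

    ¬bypass : ∀ {v a b k} → Adj G v a → Adj G v b → a ≢ b → ¬ Adj G a b → ¬ Walk (¬_ ∘ Near v) a b k
    ¬bypass va vb a≢b ¬ab w =
      induced-walk _ w λ (_ , w′ , induced) → ¬induced-bypass va vb a≢b ¬ab w′ induced

    private-neighbours-disconnected : ∀ {R v u u′ x x′} → (∀ {z} → z ∈ R → ¬ Near v z) →
      Adj G v u → Adj G v u′ → Apart u u′ → x ∈ R → Adj G u x → Adj G u′ x′ → ¬ Connected R x x′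
    private-neighbours-disconnected far vu vu′ (u≢u′ , ¬uu′) x∈R ux u′x′ x~x′ =
      let _ , w = connected⇒walk x~x′ x∈R ux (Adj-sym u′x′) in ¬bypass vu vu′ u≢u′ ¬uu′ (walk-map far w)

  -- The greedy invariant

  greedy-⊆ : ∀ {R S} → GreedyRun G R S → S ⊆ R
  greedy-⊆ (done _) x∈⊥ = contradiction x∈⊥ ∉⊥
  greedy-⊆ (step v v∈R _ run) x∈S with x∈p∪q⁻ ⁅ v ⁆ _ x∈S
  ... | inj₁ x∈⁅v⁆ = subst (_∈ _) (sym (x∈⁅y⁆⇒x≡y v x∈⁅v⁆)) v∈R
  ... | inj₂ x∈S′ = proj₁ (∈∖N[]⁻ (greedy-⊆ run x∈S′))

  Near-Apart⇒Adj : ∀ {v x y} → Near v x → Near v y → Apart x y → Adj G v x × Adj G v y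
  Near-Apart⇒Adj (inj₁ refl) (inj₁ refl) (x≢y , _) = contradiction refl x≢y
  Near-Apart⇒Adj (inj₁ refl) (inj₂ vy) (_ , ¬xy) = contradiction vy ¬xy
  Near-Apart⇒Adj (inj₂ vx) (inj₁ refl) (_ , ¬xy) = contradiction (Adj-sym vx) ¬xy
  Near-Apart⇒Adj (inj₂ vx) (inj₂ vy) _ = vx , vy

  Near-Apart⇒Adj-all : ∀ {v T} → 2 ≤ length T → All (Near v) T → AllPairs Apart T → All (Adj G v) T
  Near-Apart⇒Adj-all {T = []} () _ _
  Near-Apart⇒Adj-all {T = _ ∷ []} (s≤s ()) _ _
  Near-Apart⇒Adj-all {T = _ ∷ _ ∷ _} _ (nx ∷ ny ∷ nT) ((x#y ∷ x#T) ∷ _) =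
    proj₁ (Near-Apart⇒Adj nx ny x#y) ∷
    All.zipWith (λ (nz , x#z) → proj₂ (Near-Apart⇒Adj nx nz x#z)) (ny ∷ nT , x#y ∷ x#T)

  Apart-∈⇒¬Adj : ∀ {u T} → AllPairs Apart T → u ∈ₗ T → All (¬_ ∘ Adj G u) T
  Apart-∈⇒¬Adj (u#T ∷ _) (here refl) = Adj-irrefl ∷ All.map proj₂ u#T
  Apart-∈⇒¬Adj (x#T ∷ T#) (there u∈T) =
    (λ ux → proj₂ (All.lookup x#T u∈T) (Adj-sym ux)) ∷ Apart-∈⇒¬Adj T# u∈T

  MinDegree : Subset n → Fin n → Set
  MinDegree R v = ∀ u → u ∈ R → deg G R v ≤ deg G R u

  private-neighbour : ∀ {R v u T} → MinDegree R v → u ∈ R → Unique T →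
                      All (λ t → t ∈ R × Adj G v t × ¬ Adj G u t) T → 2 ≤ length T →
                      DoubleNegation (∃ λ x → x ∈ R ∖N[ v ] × Adj G u x)
  private-neighbour {R} {v} {u} {T} min u∈R T! T-ok 2≤T ∄x = <⇒≱ 2≤T T≤1
    where
    Nu = elements (N G u ∩ R)
    Nu! : Unique Nu
    Nu! = elements-unique (N G u ∩ R)
    L = filter (∁? (_≟ v)) Nu
    in-N[v] : ∀ {z} → z ∈ N G u ∩ R × z ≢ v → z ∈ N G v ∩ R × Adj G u z
    in-N[v] {z} (z∈NuR , z≢v) = x∈p∩q⁺ (Adj⇒∈N vz , z∈R) , uz
      where
      z∈R = proj₂ (x∈p∩q⁻ _ _ z∈NuR)
      uz = ∈N⇒Adj (proj₁ (x∈p∩q⁻ _ _ z∈NuR))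
      vz = decidable-stable (Adj? v z) λ ¬vz → ∄x (z , ∈∖N[]⁺ z∈R [ z≢v , ¬vz ] , uz)
    L-ok : All (λ z → z ∈ N G v ∩ R × Adj G u z) L
    L-ok = All.zipWith in-N[v]
             (All.filter⁺ (∁? (_≟ v)) (elements⊆ (N G u ∩ R)) , All.all-filter (∁? (_≟ v)) Nu)
    T++L! : Unique (T ++ L)
    T++L! = AllPairs.++⁺ T! (AllPairs.filter⁺ (∁? (_≟ v)) Nu!)
              (All.map (λ (_ , _ , ¬ut) → All.map (λ (_ , uz) t≡z → ¬ut (subst (Adj G u) (sym t≡z) uz))
                                                  L-ok)
                       T-ok)
    T++L⊆ : All (_∈ N G v ∩ R) (T ++ L)
    T++L⊆ = All.++⁺ (All.map (λ (t∈R , vt , _) → x∈p∩q⁺ (Adj⇒∈N vt , t∈R)) T-ok) (All.map proj₁ L-ok)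
    T≤1 : length T ≤ 1
    T≤1 = +-cancelʳ-≤ (length L) (length T) 1 (begin
      length T + length L  ≡⟨ length-++ T ⟨
      length (T ++ L)      ≤⟨ length≤∣∣ T++L! T++L⊆ ⟩
      deg G R v            ≤⟨ min u u∈R ⟩
      deg G R u            ≡⟨ length-elements (N G u ∩ R) ⟨
      length Nu            ≤⟨ length≤1+length-filter-∁ (_≟ v) Nu
                                (length≤1 (λ x≡v y≡v → trans x≡v (sym y≡v))
                                  (AllPairs.filter⁺ (_≟ v) Nu!) (All.all-filter (_≟ v) Nu)) ⟩
      1 + length L         ∎)
      where open ≤-Reasoning

  record Packing (R : Subset n) : Set where
    field
      indep : List (Fin n)
      reps : List (Fin n)
      indep⊆R : All (_∈ R) indep
      indep-apart : AllPairs Apart indep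
      reps⊆R : All (_∈ R) reps
      reps-disconnected : AllPairs (λ x y → ¬ Connected R x y) reps

    weight : ℕ
    weight = length indep + length reps

  open Packing

  module PackingStep (chordal : Chordal G) {R v} (v∈R : v ∈ R) (min : MinDegree R v) (P : Packing R)
                     (connected? : Decidable (Connected R v)) where

    R′ = R ∖N[ v ]
    T = filter (Near? v) (indep P)
    J′ = filter (∁? (Near? v)) (indep P)
    W′ = filter (∁? connected?) (reps P)

    W′⊆R′ : All (_∈ R′) W′
    W′⊆R′ = All.zipWith (λ (z∈R , ¬v~z) → ∈∖N[]⁺ z∈R (¬v~z ∘ Near⇒Connected v∈R z∈R))
              (All.filter⁺ (∁? connected?) (reps⊆R P) , All.all-filter (∁? connected?) (reps P))

    length-reps : length (reps P) ≤ suc (length W′)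
    length-reps = length≤1+length-filter-∁ connected? (reps P)
      (length≤1 (λ v~x v~y → Connected-sym v~x ◅◅ v~y)
        (AllPairs.filter⁺ connected? (reps-disconnected P)) (All.all-filter connected? (reps P)))

    restrict : ∀ X → All (_∈ R′) X → AllPairs (λ x y → ¬ Connected R′ x y) X →
               All (λ x → All (¬_ ∘ Connected R′ x) W′) X → Packing R′
    restrict X X⊆R′ X-disconnected X-W′-disconnected = record
      { indep = J′
      ; reps = X ++ W′
      ; indep⊆R = All.zipWith (λ (z∈R , ¬near) → ∈∖N[]⁺ z∈R ¬near)
                    (All.filter⁺ (∁? (Near? v)) (indep⊆R P) , All.all-filter (∁? (Near? v)) (indep P))
      ; indep-apart = AllPairs.filter⁺ (∁? (Near? v)) (indep-apart P)
      ; reps⊆R = All.++⁺ X⊆R′ W′⊆R′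
      ; reps-disconnected = AllPairs.++⁺ X-disconnected
          (AllPairs.map (λ ¬x~y → ¬x~y ∘ Connected-mono (proj₁ ∘ ∈∖N[]⁻))
            (AllPairs.filter⁺ (∁? connected?) (reps-disconnected P)))
          X-W′-disconnected
      }

    weight-restrict : ∀ X → length T ≤ suc (length X) → weight P ≤ 2 + (length J′ + length (X ++ W′))
    weight-restrict X T≤1+X = begin
      length (indep P) + length (reps P)
        ≡⟨ cong (_+ length (reps P)) (length-filter-∁ (Near? v) (indep P)) ⟩
      length T + length J′ + length (reps P)
        ≤⟨ +-mono-≤ (+-monoˡ-≤ (length J′) T≤1+X) length-reps ⟩
      suc (length X) + length J′ + suc (length W′)
        ≡⟨ restrict-length (length X) (length J′) (length W′) ⟩
      2 + (length J′ + (length X + length W′))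
        ≡⟨ cong (λ l → 2 + (length J′ + l)) (length-++ X) ⟨
      2 + (length J′ + length (X ++ W′))
        ∎
      where open ≤-Reasoning

    Private : Fin n → Fin n → Set
    Private u x = u ∈ R × Adj G v u × x ∈ R′ × Adj G u x

    shrink-large : 2 ≤ length T → DoubleNegation (Σ (Packing R′) λ P′ → weight P ≤ 2 + weight P′)
    shrink-large 2≤T = do
      private-nbrs ← All.sequenceM _ ¬¬-Monad (All.tabulate private-nbr)
      let X , T∼X = choose private-nbrs
      pure (restrict X (Pointwise⇒All (proj₁ ∘ proj₂ ∘ proj₂) T∼X)
                       (Pointwise⇒AllPairs disconnected T-apart T∼X)
                       (Pointwise⇒All W′-apart T∼X)
           , weight-restrict X (≤-trans (≤-reflexive (Pointwise-length T∼X)) (n≤1+n _)))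
      where
      T⊆R = All.filter⁺ (Near? v) (indep⊆R P)
      T-apart = AllPairs.filter⁺ (Near? v) (indep-apart P)
      T-adj = Near-Apart⇒Adj-all 2≤T (All.all-filter (Near? v) (indep P)) T-apart
      private-nbr : ∀ {u} → u ∈ₗ T → DoubleNegation (∃ (Private u))
      private-nbr u∈T = do
        x , x∈R′ , ux ← private-neighbour min (All.lookup T⊆R u∈T) (AllPairs.map proj₁ T-apart)
                          (All.zip (T⊆R , All.zip (T-adj , Apart-∈⇒¬Adj T-apart u∈T))) 2≤T
        pure (x , All.lookup T⊆R u∈T , All.lookup T-adj u∈T , x∈R′ , ux)
      disconnected : ∀ {u u′ x x′} → Apart u u′ → Private u x → Private u′ x′ → ¬ Connected R′ x x′
      disconnected u#u′ (_ , vu , x∈R′ , ux) (_ , vu′ , _ , u′x′) =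
        private-neighbours-disconnected chordal (proj₂ ∘ ∈∖N[]⁻) vu vu′ u#u′ x∈R′ ux u′x′
      W′-apart : ∀ {u x} → Private u x → All (¬_ ∘ Connected R′ x) W′
      W′-apart (u∈R , vu , x∈R′ , ux) =
        All.map (λ ¬v~w x~w → ¬v~w (v~x ◅◅ Connected-mono (proj₁ ∘ ∈∖N[]⁻) x~w))
          (All.all-filter (∁? connected?) (reps P))
        where v~x = (v∈R , u∈R , vu) ◅ (u∈R , proj₁ (∈∖N[]⁻ x∈R′) , ux) ◅ ε

    shrink : DoubleNegation (Σ (Packing R′) λ P′ → weight P ≤ 2 + weight P′)
    shrink with length T ≤? 1
    ... | yes T≤1 = pure (restrict [] [] [] [] , weight-restrict [] T≤1)
    ... | no T≰1 = shrink-large (≰⇒> T≰1)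

  packing-step : Chordal G → ∀ {R v} → v ∈ R → MinDegree R v → (P : Packing R) →
                 DoubleNegation (Σ (Packing (R ∖N[ v ])) λ P′ → weight P ≤ 2 + weight P′)
  packing-step chordal v∈R min P = ¬¬-decidable _ >>= PackingStep.shrink chordal v∈R min P

  packing-bound : Chordal G → ∀ {R S} → GreedyRun G R S → (P : Packing R) → weight P ≤ 2 * ∣ S ∣
  packing-bound _ (done R-empty) P =
    ≤-trans (+-mono-≤ (length-empty (indep⊆R P)) (length-empty (reps⊆R P))) z≤n
    where
    length-empty : ∀ {xs} → All (_∈ _) xs → length xs ≤ 0
    length-empty [] = z≤n
    length-empty (x∈R ∷ _) = contradiction x∈R (R-empty _)
  -- Connectivity is not decided constructively, so packing-step only holds under double
  -- negation; the goal is a decidable inequality and hence stable.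
  packing-bound chordal (step {S = S′} v v∈R min run) P = decidable-stable (_ ≤? _) do
    P′ , P≤2+P′ ← packing-step chordal v∈R min P
    pure (begin
      weight P           ≤⟨ P≤2+P′ ⟩
      2 + weight P′      ≤⟨ +-monoʳ-≤ 2 (packing-bound chordal run P′) ⟩
      2 + 2 * ∣ S′ ∣     ≡⟨ *-suc 2 ∣ S′ ∣ ⟨
      2 * suc ∣ S′ ∣     ≤⟨ *-monoʳ-≤ 2 (x∉p⇒∣p∣<∣⁅x⁆∪p∣ v∉S′) ⟩
      2 * ∣ ⁅ v ⁆ ∪ S′ ∣ ∎)
    where
    open ≤-Reasoning
    v∉S′ : v ∉ S′
    v∉S′ v∈S′ = proj₂ (∈∖N[]⁻ (greedy-⊆ run v∈S′)) (inj₁ refl)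

theorem1 : ∀ {n : ℕ} (G : Graph n) → Chordal G →
    (I* : Subset n) → MaximumIndependent G I* →
    (S : Subset n) → GreedyOutput G S →
    ∣ I* ∣ ≤ 2 * ∣ S ∣
theorem1 G chordal I* (I*-independent , _) S run = begin
  ∣ I* ∣                 ≡⟨ length-elements I* ⟨
  length (elements I*)   ≡⟨ +-identityʳ _ ⟨
  Packing.weight P       ≤⟨ packing-bound G chordal run P ⟩
  2 * ∣ S ∣              ∎
  where
  open ≤-Reasoning
  P : Packing G ⊤
  P = record
    { indep = elements I*
    ; reps = []
    ; indep⊆R = All.universal (λ _ → ∈⊤) _
    ; indep-apart = AllPairs.zip (elements-unique I* , All⇒AllPairs (I*-independent _ _) (elements⊆ I*))
    ; reps⊆R = []
    ; reps-disconnected = []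
    }
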